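{- For all $x,y\in 2^\omega$ and $f,g\in\omega^{\uparrow\omega}$, if $f\not\sqsubseteq g$ then $E_{x,f}\not\subseteq E_{y,g}$.
   Context: $\omega^{\uparrow\omega}$ denotes the set of strictly increasing functions from $\omega$ to $\omega$. For $f,g\in\omega^{\uparrow\omega}$, write $f\sqsubseteq g$ if for all but finitely many $n<\omega$ there is $k<\omega$ such that $[f(k),f(k+1))\subseteq[g(n),g(n+1))$. For $x\in 2^\omega$ and $f\in\omega^{\uparrow\omega}$, let $E_{x,f}=\{z\in 2^\omega: \exists m<\omega\,\forall n\geq m\,\exists j\in[f(n),f(n+1))\,(z(j)\neq x(j))\}$. -}

module Defs where

open import Data.Nat using (ℕ; suc; _≤_; _<_; _≥_)
open import Data.Bool using (Bool)
open import Data.Product using (Σ; _×_; ∃-syntax)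
open import Relation.Nullary using (¬_)
open import Relation.Binary.PropositionalEquality using (_≡_)

Cantor : Set
Cantor = ℕ → Bool

StrictlyIncreasing : (ℕ → ℕ) → Set
StrictlyIncreasing f = ∀ n → f n < f (suc n)

IncFun : Set
IncFun = Σ (ℕ → ℕ) StrictlyIncreasing

IntervalSub : ℕ → ℕ → ℕ → ℕ → Set
IntervalSub a b c d = ∀ j → a ≤ j → j < b → (c ≤ j × j < d)

_⊑_ : (ℕ → ℕ) → (ℕ → ℕ) → Set
f ⊑ g = ∃[ m ] (∀ n → n ≥ m → ∃[ k ] IntervalSub (f k) (f (suc k)) (g n) (g (suc n)))

E : Cantor → (ℕ → ℕ) → Cantor → Set
E x f z = ∃[ m ] (∀ n → n ≥ m → ∃[ j ] (f n ≤ j × j < f (suc n) × ¬ (z j ≡ x j)))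

_⊆E_ : (Cantor → Set) → (Cantor → Set) → Set
A ⊆E B = ∀ z → A z → B z

-- Call the block [g n, g (n+1)) a misfit if it contains no whole block of f. Pick misfits
-- greedily, never two consecutive ones, and let z agree with y on the picked blocks and
-- differ from x everywhere else. Every block of f contains a point where z differs from x:
-- its first point, unless that lies in a picked misfit block n, in which case the f-block
-- runs past g (n+1), the first point of the unpicked block n+1. So z ∈ E x f. If also
-- z ∈ E y g, then z differs from y somewhere in almost every g-block, so from some m on
-- nothing is picked; by greediness no block n+1 with n ≥ m is then a misfit, i.e. f ⊑ g.
module Submission where

open import Defs
open import Data.Nat using (ℕ; zero; suc; _≤_; _<_; _≥_; z≤n; s≤s; _≤?_; _<?_; anyUpTo?)
open import Data.Nat.Properties using
  (≤-refl; ≤-trans; ≤-antisym; ≤-pred; <⇒≤; <-≤-trans; ≤-<-trans; <⇒≱; ≰⇒>; m≤n⇒m<n∨m≡n; m≤n⇒m≤1+n)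
open import Data.Bool using (not)
open import Data.Bool.Properties using (not-¬)
open import Data.Empty using (⊥-elim)
open import Data.Product using (_×_; _,_; ∃; ∃-syntax; proj₁)
open import Data.Sum using (inj₁; inj₂)
open import Function using (_∘_)
open import Level using (0ℓ)
open import Relation.Nullary using (¬_; Dec; yes; no; ¬?; _×-dec_)
open import Relation.Nullary.Decidable using (map′; decidable-stable)
open import Relation.Unary using (Pred; Decidable)
open import Relation.Binary.PropositionalEquality using (_≡_; _≢_; refl; subst; ≢-sym)

search-below : ∀ {p} {P : Pred ℕ p} → Decidable P → ∀ v → (∀ {n} → P n → n < v) → Dec (∃ P)
search-below P? v bound =
  map′ (λ (n , _ , p) → n , p) (λ (n , p) → n , bound p , p) (anyUpTo? P? v)

module StrictlyIncreasingProperties {h : ℕ → ℕ} (h-inc : StrictlyIncreasing h) where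

  n≤h[n] : ∀ n → n ≤ h n
  n≤h[n] zero    = z≤n
  n≤h[n] (suc n) = ≤-<-trans (n≤h[n] n) (h-inc n)

  h-mono-≤ : ∀ {a b} → a ≤ b → h a ≤ h b
  h-mono-≤ {b = zero}  z≤n = ≤-refl
  h-mono-≤ {b = suc b} a≤1+b with m≤n⇒m<n∨m≡n a≤1+b
  ... | inj₁ (s≤s a≤b) = ≤-trans (h-mono-≤ a≤b) (<⇒≤ (h-inc b))
  ... | inj₂ refl      = ≤-refl

  h-cancel-< : ∀ {a b} → h a < h b → a < b
  h-cancel-< ha<hb = ≰⇒> (<⇒≱ ha<hb ∘ h-mono-≤)

Block : (ℕ → ℕ) → ℕ → Pred ℕ 0ℓ
Block h n j = h n ≤ j × j < h (suc n)

block-unique : ∀ {h} → StrictlyIncreasing h → ∀ {a b j} → Block h a j → Block h b j → a ≡ b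
block-unique h-inc (h[a]≤j , j<h[a+1]) (h[b]≤j , j<h[b+1]) =
  ≤-antisym (≤-pred (h-cancel-< (≤-<-trans h[a]≤j j<h[b+1])))
            (≤-pred (h-cancel-< (≤-<-trans h[b]≤j j<h[a+1])))
  where open StrictlyIncreasingProperties h-inc

GreedySparse : ∀ {q} → Pred ℕ q → Pred ℕ q
GreedySparse Q zero    = Q zero
GreedySparse Q (suc n) = Q (suc n) × ¬ GreedySparse Q n

greedySparse? : ∀ {q} {Q : Pred ℕ q} → Decidable Q → Decidable (GreedySparse Q)
greedySparse? Q? zero    = Q? zero
greedySparse? Q? (suc n) = Q? (suc n) ×-dec ¬? (greedySparse? Q? n)

greedySparse⇒member : ∀ {q} {Q : Pred ℕ q} n → GreedySparse Q n → Q n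
greedySparse⇒member zero    q       = q
greedySparse⇒member (suc n) (q , _) = q

module Witness (x y : Cantor) {f g : ℕ → ℕ}
               (f-inc : StrictlyIncreasing f) (g-inc : StrictlyIncreasing g) where

  open StrictlyIncreasingProperties f-inc using () renaming (n≤h[n] to n≤f[n])
  open StrictlyIncreasingProperties g-inc using () renaming (n≤h[n] to n≤g[n])

  Fits : Pred ℕ 0ℓ
  Fits n = ∃[ k ] (g n ≤ f k × f (suc k) ≤ g (suc n))

  fits? : Decidable Fits
  fits? n = search-below (λ k → (g n ≤? f k) ×-dec (f (suc k) ≤? g (suc n))) (g (suc n))
                         (λ {k} (_ , f[k+1]≤g[n+1]) → ≤-trans (n≤f[n] (suc k)) f[k+1]≤g[n+1])

  fits⇒IntervalSub : ∀ {n} → ((k , _) : Fits n) → IntervalSub (f k) (f (suc k)) (g n) (g (suc n))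
  fits⇒IntervalSub (k , g[n]≤f[k] , f[k+1]≤g[n+1]) j f[k]≤j j<f[k+1] =
    ≤-trans g[n]≤f[k] f[k]≤j , <-≤-trans j<f[k+1] f[k+1]≤g[n+1]

  misfit-overrun : ∀ {n k} → ¬ Fits n → Block g n (f k) → Block f k (g (suc n))
  misfit-overrun ¬fits (g[n]≤f[k] , f[k]<g[n+1]) =
    <⇒≤ f[k]<g[n+1] , ≰⇒> (λ f[k+1]≤g[n+1] → ¬fits (_ , g[n]≤f[k] , f[k+1]≤g[n+1]))

  Picked : Pred ℕ 0ℓ
  Picked = GreedySparse (¬_ ∘ Fits)

  Covered : Pred ℕ 0ℓ
  Covered j = ∃[ n ] (Picked n × Block g n j)

  covered? : Decidable Covered
  covered? j = search-below (λ n → greedySparse? (¬? ∘ fits?) n ×-dec block? n) (suc j)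
                            (λ {n} (_ , g[n]≤j , _) → s≤s (≤-trans (n≤g[n] n) g[n]≤j))
    where
    block? : ∀ n → Dec (Block g n j)
    block? n = (g n ≤? j) ×-dec (j <? g (suc n))

  z : Cantor
  z j with covered? j
  ... | yes _ = y j
  ... | no _  = not (x j)

  z-covered : ∀ {j} → Covered j → z j ≡ y j
  z-covered {j} c with covered? j
  ... | yes _ = refl
  ... | no ¬c = ⊥-elim (¬c c)

  z-uncovered : ∀ {j} → ¬ Covered j → z j ≢ x j
  z-uncovered {j} ¬c with covered? j
  ... | yes c = ⊥-elim (¬c c)
  ... | no _  = ≢-sym (not-¬ refl)

  start-of-next-block-uncovered : ∀ {n} → Picked n → ¬ Covered (g (suc n))
  start-of-next-block-uncovered {n} picked (n′ , picked′ , in-n′) =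
    not-picked (subst Picked (block-unique g-inc in-n′ (≤-refl , g-inc (suc n))) picked′)
    where
    not-picked : ¬ Picked (suc n)
    not-picked (_ , ¬picked) = ¬picked picked

  z-differs-from-x-in-block : ∀ k → ∃[ j ] (f k ≤ j × j < f (suc k) × z j ≢ x j)
  z-differs-from-x-in-block k with covered? (f k)
  ... | no ¬c = f k , ≤-refl , f-inc k , z-uncovered ¬c
  ... | yes (n , picked , in-n)
    with f[k]≤g[n+1] , g[n+1]<f[k+1] ← misfit-overrun (greedySparse⇒member n picked) in-n
    = g (suc n) , f[k]≤g[n+1] , g[n+1]<f[k+1] , z-uncovered (start-of-next-block-uncovered picked)

  z∈E[x,f] : E x f z
  z∈E[x,f] = 0 , λ k _ → z-differs-from-x-in-block k

  eventually-unpicked : E y g z → ∃[ m ] (∀ n → n ≥ m → ¬ Picked n)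
  eventually-unpicked (m , differs) = m , λ n n≥m picked →
    let (j , g[n]≤j , j<g[n+1] , z[j]≢y[j]) = differs n n≥m
    in z[j]≢y[j] (z-covered (n , picked , g[n]≤j , j<g[n+1]))

  z∈E[y,g]⇒f⊑g : E y g z → f ⊑ g
  z∈E[y,g]⇒f⊑g z∈E[y,g] with m , unpicked ← eventually-unpicked z∈E[y,g] =
    suc m , λ { (suc n) (s≤s m≤n) → _ , fits⇒IntervalSub (fits n m≤n) }
    where
    fits : ∀ n → m ≤ n → Fits (suc n)
    fits n m≤n = decidable-stable (fits? (suc n)) λ ¬fits →
      unpicked (suc n) (m≤n⇒m≤1+n m≤n) (¬fits , unpicked n m≤n)

lemma1p3 : (x y : Cantor) (f g : IncFun) →
    ¬ (proj₁ f ⊑ proj₁ g) → ¬ (E x (proj₁ f) ⊆E E y (proj₁ g))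
lemma1p3 x y (f , f-inc) (g , g-inc) f⋢g E[x,f]⊆E[y,g] =
  f⋢g (z∈E[y,g]⇒f⊑g (E[x,f]⊆E[y,g] z z∈E[x,f]))
  where open Witness x y f-inc g-inc
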